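{- Let $n\ge 1$. For a permutation $p=(p_1,\dots,p_n)$ of $\{1,\dots,n\}$ with $p_1=1$ that avoids the pattern $1342$, let $f(p)$ be the rooted tree on $n$ nodes forming a single path, with nodes numbered $1,2,\dots,n$ from the leaf (node $1$) to the root (node $n$), where node $i$ ($1\le i\le n-1$) receives the label \[ l(i)=\#\{\, j\le i \;:\; p_j>p_s \text{ for at least one } s>i\,\}, \] and the root receives the label $l(n)=l(n-1)$. Then $f$ is a bijection from the set of $1342$-avoiding permutations of length $n$ with first entry $1$ onto the set of $\beta(0,1)$-trees on $n$ vertices that consist of a single path.
   Context: A permutation $p=(p_1,\dots,p_n)$ avoids a pattern $q=(q_1,\dots,q_k)$ (a permutation of $\{1,\dots,k\}$) if there are no indices $i_1<\dots<i_k$ such that $(p_{i_1},\dots,p_{i_k})$ is order-isomorphic to $q$ (i.e. $p_{i_a}<p_{i_b}$ iff $q_a<q_b$). A $\beta(0,1)$-tree is a rooted plane tree with a nonnegative integer label $l(v)$ on each vertex $v$ such that: if $v$ is a leaf then $l(v)=0$; if $v$ is the root with children $v_1,\dots,v_k$ then $l(v)=\sum_{i=1}^k l(v_i)$; if $v$ is an internal non-root node with children $v_1,\dots,v_k$ then $l(v)\le 1+\sum_{i=1}^k l(v_i)$. -}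

module Defs where

open import Data.Nat using (ℕ; zero; suc; _+_; _≤_; _<_; _<ᵇ_)
open import Data.Bool using (Bool; true; false)
open import Data.Fin using (Fin; toℕ)
open import Data.Vec using (Vec; lookup; _∷_; [])
open import Data.List using (List; []; _∷_; length; filterᵇ; map; downFrom; upTo)
open import Data.Bool.ListAction using (any)
open import Data.List.Relation.Unary.All using (All)
open import Data.Product using (Σ; _×_; ∃)
open import Relation.Nullary using (¬_)
open import Relation.Binary.PropositionalEquality using (_≡_)

IsPerm : ∀ {n} → Vec ℕ n → Set
IsPerm {n} p = (∀ i → 1 ≤ lookup p i × lookup p i ≤ n)
             × (∀ i j → lookup p i ≡ lookup p j → i ≡ j)

Contains : ∀ {k n} → Vec ℕ k → Vec ℕ n → Set
Contains {k} {n} q p =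
  Σ (Fin k → Fin n) λ ι →
    (∀ a b → toℕ a < toℕ b → toℕ (ι a) < toℕ (ι b))
    × (∀ a b → (lookup q a < lookup q b → lookup p (ι a) < lookup p (ι b))
             × (lookup p (ι a) < lookup p (ι b) → lookup q a < lookup q b))

Avoids : ∀ {k n} → Vec ℕ k → Vec ℕ n → Set
Avoids q p = ¬ Contains q p

pat1342 : Vec ℕ 4
pat1342 = 1 ∷ 3 ∷ 4 ∷ 2 ∷ []

-- Labels l(i) = #{ j ≤ i : p_j > p_s for some s > i }  (1-based i, j, s)

-- 1-based value p_j of a vector (0 outside the range; only used in range)
val : ∀ {n} → Vec ℕ n → ℕ → ℕ
val [] j = 0
val (x ∷ xs) zero = 0
val (x ∷ xs) (suc zero) = x
val (x ∷ xs) (suc (suc j)) = val xs (suc j)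

range : ℕ → ℕ → List ℕ
range a m = map (λ k → a + suc k) (upTo m)

label : ∀ {n} → Vec ℕ n → ℕ → ℕ
label {n} p i =
  length (filterᵇ (λ j → any (λ s → val p s <ᵇ val p j) (range i (n Data.Nat.∸ i)))
                  (range 0 i))

data PTree : Set where
  node : ℕ → List PTree → PTree

labelOf : PTree → ℕ
labelOf (node l _) = l

sumLabels : List PTree → ℕ
sumLabels [] = 0
sumLabels (t ∷ ts) = labelOf t + sumLabels ts

mutual
  size : PTree → ℕ
  size (node _ cs) = suc (sizes cs)

  sizes : List PTree → ℕ
  sizes [] = 0
  sizes (t ∷ ts) = size t + sizes ts

data NonRootOK : PTree → Set where
  leaf     : NonRootOK (node 0 [])
  internal : ∀ {l c cs} → All NonRootOK (c ∷ cs)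
           → l ≤ 1 + sumLabels (c ∷ cs) → NonRootOK (node l (c ∷ cs))

IsBeta01 : PTree → Set
IsBeta01 (node l cs) = l ≡ sumLabels cs × All NonRootOK cs

data IsPath : PTree → Set where
  end  : ∀ {l} → IsPath (node l [])
  step : ∀ {l t} → IsPath t → IsPath (node l (t ∷ []))

chain : ℕ → List ℕ → PTree
chain x [] = node x []
chain x (y ∷ ys) = node x (chain y ys ∷ [])

-- f(p) for p of length n = suc m: root (node n) has label l(n-1) = l(m),
-- then nodes n-1, …, 1 with labels l(n-1), …, l(1).
f : ∀ {m} → Vec ℕ (suc m) → PTree
f {m} p = chain (label p m) (map (λ k → label p (suc k)) (downFrom m))

InDomain : ∀ {m} → Vec ℕ (suc m) → Set
InDomain p = IsPerm p × val p 1 ≡ 1 × Avoids pat1342 p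

InCodomain : ℕ → PTree → Set
InCodomain n t = IsBeta01 t × IsPath t × size t ≡ n

{-# OPTIONS --safe #-}
-- Positions are 0-based, and l(i) counts the positions x < i that are alive at time i:
-- some entry at a position ≥ i is smaller than p_x. If p has no 231 pattern after its first
-- entry, the alive positions behave like a stack: x stays alive exactly until popTime x, the
-- first later time at which the label falls back to l(x) or below, and the values of p increase
-- along the order in which positions are popped. So p is the rank in this pop order and is
-- determined by its labels. Conversely, every sequence with l(0) = l(1) = 0 and
-- l(i+1) ≤ l(i) + 1 (exactly the labellings of single-path β(0,1)-trees) is the label sequence
-- of the rank of its own pop order, which avoids 231 and starts with 1.
module Submission where

open import Defs
open import Level using (0ℓ)
open import Data.Nat using (ℕ; zero; suc; _+_; _∸_; _⊓_; _≤_; _<_; _<ᵇ_; z≤n; s≤s; z<s; s<s)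
open import Data.Nat.Properties
open import Data.Product using (Σ; _×_; _,_; proj₁; proj₂; ∃-syntax)
open import Data.Sum using (_⊎_; inj₁; inj₂)
open import Data.Bool using (Bool; T)
open import Data.Bool.ListAction using (any)
open import Data.Fin as Fin using (Fin; toℕ; fromℕ<)
open import Data.Fin.Properties using (toℕ-fromℕ<; toℕ-injective; toℕ<n)
open import Data.Vec using (Vec; []; _∷_; lookup; tabulate)
open import Data.Vec.Properties using (lookup∘tabulate)
open import Data.List using ([]; _∷_; length; filterᵇ; map; downFrom; applyUpTo; [_]; _∷ʳ_; _++_)
open import Data.List.Properties
  using (length-map; length-downFrom; length-++; filter-++; filter-accept; filter-reject; applyUpTo-∷ʳ; map-upTo)
open import Data.List.Relation.Unary.All using ([]; _∷_)
open import Data.List.Relation.Unary.Any.Properties using (any⇔; applyUpTo⁺; applyUpTo⁻)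
open import Function using (_∘_; case_of_)
open import Function.Bundles using (_⇔_; mk⇔; Equivalence)
import Function.Properties.Equivalence as Eq
open import Relation.Nullary using (¬_; Dec; yes; no; contradiction)
open import Relation.Nullary.Decidable using (T?; _×-dec_; _⊎-dec_; decidable-stable)
open import Relation.Unary using (Pred; Decidable; _∩_; ∁; U)
open import Relation.Unary.Properties using (_∩?_; ∁?; U?)
open import Relation.Binary using (Rel; IsStrictTotalOrder; Trichotomous; Tri; tri<; tri≈; tri>)
open import Relation.Binary.PropositionalEquality
  using (_≡_; refl; sym; trans; cong; cong₂; subst; subst₂; isEquivalence; resp₂; ≢-sym; module ≡-Reasoning)

private variable
  P P′ : Pred ℕ 0ℓ

count : Decidable P → ℕ → ℕ
count P? zero = 0
count P? (suc k) with P? k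
... | yes _ = suc (count P? k)
... | no _  = count P? k

module _ (P? : Decidable P) where

  count-≤ : ∀ k → count P? k ≤ k
  count-≤ zero = z≤n
  count-≤ (suc k) with P? k
  ... | yes _ = s≤s (count-≤ k)
  ... | no _  = m≤n⇒m≤1+n (count-≤ k)

  count-suc-≤ : ∀ k → count P? (suc k) ≤ suc (count P? k)
  count-suc-≤ k with P? k
  ... | yes _ = ≤-refl
  ... | no _  = n≤1+n _

  count-suc-yes : ∀ {k} → P k → count P? (suc k) ≡ suc (count P? k)
  count-suc-yes {k} Pk with P? k
  ... | yes _  = refl
  ... | no ¬Pk = contradiction Pk ¬Pk

  count-suc-no : ∀ {k} → ¬ P k → count P? (suc k) ≡ count P? k
  count-suc-no {k} ¬Pk with P? k
  ... | yes Pk = contradiction Pk ¬Pk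
  ... | no _   = refl

  count-≤-suc : ∀ k → count P? k ≤ count P? (suc k)
  count-≤-suc k with P? k
  ... | yes _ = n≤1+n _
  ... | no _  = ≤-refl

  count-monoʳ : ∀ {k k′} → k ≤ k′ → count P? k ≤ count P? k′
  count-monoʳ {k′ = zero}   z≤n = z≤n
  count-monoʳ {k′ = suc k′} k≤1+k′ with m≤n⇒m<n∨m≡n k≤1+k′
  ... | inj₂ refl       = ≤-refl
  ... | inj₁ (s≤s k≤k′) = ≤-trans (count-monoʳ k≤k′) (count-≤-suc k′)

  count-pos : ∀ {x k} → x < k → P x → 1 ≤ count P? k
  count-pos {x} {k} x<k Px = begin
    1                    ≤⟨ s≤s z≤n ⟩
    suc (count P? x)     ≡⟨ count-suc-yes Px ⟨
    count P? (suc x)     ≤⟨ count-monoʳ x<k ⟩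
    count P? k           ∎
    where open ≤-Reasoning

  count-zero : ∀ k → (∀ x → x < k → ¬ P x) → count P? k ≡ 0
  count-zero zero _ = refl
  count-zero (suc k) none with P? k
  ... | yes Pk = contradiction Pk (none k ≤-refl)
  ... | no _   = count-zero k (λ x x<k → none x (m<n⇒m<1+n x<k))

  count-≤1 : ∀ k → (∀ x y → x < k → y < k → P x → P y → x ≡ y) → count P? k ≤ 1
  count-≤1 zero _ = z≤n
  count-≤1 (suc k) unique with P? k
  ... | yes Pk = s≤s (≤-reflexive (count-zero k λ x x<k Px →
                   <-irrefl (unique x k (m<n⇒m<1+n x<k) ≤-refl Px Pk) x<k))
  ... | no _   = count-≤1 k (λ x y x<k y<k → unique x y (m<n⇒m<1+n x<k) (m<n⇒m<1+n y<k))

count-mono : (P? : Decidable P) (P′? : Decidable P′) →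
             ∀ k → (∀ x → x < k → P x → P′ x) → count P? k ≤ count P′? k
count-mono P? P′? zero _ = z≤n
count-mono P? P′? (suc k) P⊆P′ with P? k | P′? k | count-mono P? P′? k (λ x x<k → P⊆P′ x (m<n⇒m<1+n x<k))
... | yes _  | yes _   | ih = s≤s ih
... | no _   | yes _   | ih = m≤n⇒m≤1+n ih
... | no _   | no _    | ih = ih
... | yes Pk | no ¬P′k | _  = contradiction (P⊆P′ k ≤-refl Pk) ¬P′k

count-cong : (P? : Decidable P) (P′? : Decidable P′) →
             ∀ k → (∀ x → x < k → P x ⇔ P′ x) → count P? k ≡ count P′? k
count-cong P? P′? k P⇔P′ =
  ≤-antisym (count-mono P? P′? k (λ x x<k → Equivalence.to (P⇔P′ x x<k)))
            (count-mono P′? P? k (λ x x<k → Equivalence.from (P⇔P′ x x<k)))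

count-split : (P? : Decidable P) (P′? : Decidable P′) →
              ∀ k → count (P? ∩? P′?) k + count (P? ∩? ∁? P′?) k ≡ count P? k
count-split P? P′? zero = refl
count-split P? P′? (suc k) with P? k | P′? k | count-split P? P′? k
... | yes _ | yes _ | ih = cong suc ih
... | yes _ | no _  | ih = trans (+-suc _ _) (cong suc ih)
... | no _  | yes _ | ih = ih
... | no _  | no _  | ih = ih

count-U : ∀ k → count U? k ≡ k
count-U zero    = refl
count-U (suc k) = cong suc (count-U k)

InjectiveBelow : ℕ → (ℕ → ℕ) → Set
InjectiveBelow n Q = ∀ x y → x < n → y < n → Q x ≡ Q y → x ≡ y

count-≤-interval : (Q : ℕ → ℕ) (P? : Decidable P) → ∀ k → InjectiveBelow k Q →
                   ∀ lo d → (∀ x → x < k → P x → lo ≤ Q x × Q x < lo + d) → count P? k ≤ d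
count-≤-interval Q P? k inj lo zero inside =
  ≤-reflexive (count-zero P? k λ x x<k Px →
    let lo≤Qx , Qx<lo+0 = inside x x<k Px in <⇒≱ (subst (Q x <_) (+-identityʳ lo) Qx<lo+0) lo≤Qx)
count-≤-interval {P = P} Q P? k inj lo (suc d) inside = begin
  count P? k                                     ≡⟨ count-split P? below? k ⟨
  count (P? ∩? below?) k + count (P? ∩? ∁? below?) k
                                                 ≤⟨ +-mono-≤ (count-≤-interval Q (P? ∩? below?) k inj lo d lower)
                                                             (count-≤1 (P? ∩? ∁? below?) k top-unique) ⟩
  d + 1                                          ≡⟨ +-comm d 1 ⟩
  suc d                                          ∎
  where
  open ≤-Reasoning
  below? : Decidable (λ x → Q x < lo + d)
  below? x = Q x <? lo + d
  lower : ∀ x → x < k → (P ∩ (λ x → Q x < lo + d)) x → lo ≤ Q x × Q x < lo + d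
  lower x x<k (Px , Qx<) = proj₁ (inside x x<k Px) , Qx<
  top : ∀ x → x < k → (P ∩ ∁ (λ x → Q x < lo + d)) x → Q x ≡ lo + d
  top x x<k (Px , Qx≮) = ≤-antisym (≤-pred (subst (Q x <_) (+-suc lo d) (proj₂ (inside x x<k Px)))) (≮⇒≥ Qx≮)
  top-unique : ∀ x y → x < k → y < k → (P ∩ ∁ (λ x → Q x < lo + d)) x → (P ∩ ∁ (λ x → Q x < lo + d)) y →
               x ≡ y
  top-unique x y x<k y<k Tx Ty = inj x y x<k y<k (trans (top x x<k Tx) (sym (top y y<k Ty)))

count-≤-value : ∀ n (Q : ℕ → ℕ) → InjectiveBelow n Q → (∀ x → x < n → 1 ≤ Q x × Q x ≤ n) →
                ∀ v → v ≤ n → count (λ y → Q y ≤? v) n ≡ v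
count-≤-value n Q inj bounds v v≤n = ≤-antisym atMost atLeast
  where
  ≤v? : Decidable (λ y → Q y ≤ v)
  ≤v? y = Q y ≤? v
  #above : ℕ
  #above = count (U? ∩? ∁? ≤v?) n
  atMost : count ≤v? n ≤ v
  atMost = count-≤-interval Q ≤v? n inj 1 v (λ x x<n Qx≤v → proj₁ (bounds x x<n) , s≤s Qx≤v)
  above : #above ≤ n ∸ v
  above = count-≤-interval Q _ n inj (suc v) (n ∸ v) λ x x<n (_ , Qx≰v) →
    ≰⇒> Qx≰v , s≤s (subst (Q x ≤_) (sym (m+[n∸m]≡n v≤n)) (proj₂ (bounds x x<n)))
  atLeast : v ≤ count ≤v? n
  atLeast = +-cancelʳ-≤ #above v _ (begin
    v + #above                        ≤⟨ +-monoʳ-≤ v above ⟩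
    v + (n ∸ v)                       ≡⟨ m+[n∸m]≡n v≤n ⟩
    n                                 ≡⟨ trans (count-split U? ≤v? n) (count-U n) ⟨
    count (U? ∩? ≤v?) n + #above      ≡⟨ cong (_+ #above) (count-cong _ ≤v? n λ _ _ → mk⇔ proj₂ (_ ,_)) ⟩
    count ≤v? n + #above              ∎)
    where open ≤-Reasoning

count-< : (P? : Decidable P) (P′? : Decidable P′) → ∀ k → (∀ x → x < k → P x → P′ x) →
          ∀ {x} → x < k → P′ x → ¬ P x → count P? k < count P′? k
count-< {P = P} {P′ = P′} P? P′? k P⊆P′ x<k P′x ¬Px = begin-strict
  count P? k                                        ≡⟨ count-cong P? (P′? ∩? P?) k P⇔P′∩P ⟩
  count (P′? ∩? P?) k                               ≡⟨ +-identityʳ _ ⟨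
  count (P′? ∩? P?) k + 0                           <⟨ +-monoʳ-< _ (count-pos (P′? ∩? ∁? P?) x<k (P′x , ¬Px)) ⟩
  count (P′? ∩? P?) k + count (P′? ∩? ∁? P?) k      ≡⟨ count-split P′? P? k ⟩
  count P′? k                                       ∎
  where
  open ≤-Reasoning
  P⇔P′∩P : ∀ y → y < k → P y ⇔ (P′ ∩ P) y
  P⇔P′∩P y y<k = mk⇔ (λ Py → P⊆P′ y y<k Py , Py) proj₂

count-≤-restrict : (P? : Decidable P) (P′? : Decidable P′) → ∀ k {x} →
                   (∀ w → w < k → P w → w < x × P′ w) → count P? k ≤ count P′? x
count-≤-restrict P? P′? zero _ = z≤n
count-≤-restrict P? P′? (suc k) {x} restrict with P? k
... | yes Pk = let k<x , P′k = restrict k ≤-refl Pk in begin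
  suc (count P? k)     ≤⟨ s≤s (count-mono P? P′? k λ w w<k Pw → proj₂ (restrict w (m<n⇒m<1+n w<k) Pw)) ⟩
  suc (count P′? k)    ≡⟨ count-suc-yes P′? P′k ⟨
  count P′? (suc k)    ≤⟨ count-monoʳ P′? k<x ⟩
  count P′? x          ∎
  where open ≤-Reasoning
... | no _   = count-≤-restrict P? P′? k λ w w<k → restrict w (m<n⇒m<1+n w<k)

first : Decidable P → ℕ → ℕ → ℕ
first P? x zero = x
first P? x (suc d) with P? x
... | yes _ = x
... | no _  = first P? (suc x) d

module _ (P? : Decidable P) where

  first-≥ : ∀ x d → x ≤ first P? x d
  first-≥ x zero = ≤-refl
  first-≥ x (suc d) with P? x
  ... | yes _ = ≤-refl
  ... | no _  = <⇒≤ (first-≥ (suc x) d)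

  first-≤ : ∀ x d → first P? x d ≤ x + d
  first-≤ x zero = ≤-reflexive (sym (+-identityʳ x))
  first-≤ x (suc d) with P? x
  ... | yes _ = m≤m+n x (suc d)
  ... | no _  = subst (first P? (suc x) d ≤_) (sym (+-suc x d)) (first-≤ (suc x) d)

  first-minimal : ∀ x d {i} → x ≤ i → i < first P? x d → ¬ P i
  first-minimal x zero x≤i i<x = contradiction x≤i (<⇒≱ i<x)
  first-minimal x (suc d) x≤i i<first with P? x
  ... | yes _  = contradiction x≤i (<⇒≱ i<first)
  ... | no ¬Px with m≤n⇒m<n∨m≡n x≤i
  ...   | inj₁ x<i  = first-minimal (suc x) d x<i i<first
  ...   | inj₂ refl = ¬Px

  first-satisfies : ∀ x d → first P? x d < x + d → P (first P? x d)
  first-satisfies x zero x<x+0 = contradiction (subst (x <_) (+-identityʳ x) x<x+0) (<-irrefl refl)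
  first-satisfies x (suc d) first<x+1+d with P? x
  ... | yes Px = Px
  ... | no _   = first-satisfies (suc x) d (subst (first P? (suc x) d <_) (+-suc x d) first<x+1+d)

first-cong : (P? : Decidable P) (P′? : Decidable P′) → ∀ x d →
             (∀ i → x ≤ i → i < x + d → P i ⇔ P′ i) → first P? x d ≡ first P′? x d
first-cong P? P′? x zero _ = refl
first-cong P? P′? x (suc d) P⇔P′ with P? x | P′? x
... | yes _  | yes _   = refl
... | no _   | no _    = first-cong P? P′? (suc x) d λ i x<i i<x+1+d →
                           P⇔P′ i (<⇒≤ x<i) (subst (i <_) (sym (+-suc x d)) i<x+1+d)
... | yes Px | no ¬P′x = contradiction (Equivalence.to (P⇔P′ x ≤-refl (m<m+n x z<s)) Px) ¬P′x
... | no ¬Px | yes P′x = contradiction (Equivalence.from (P⇔P′ x ≤-refl (m<m+n x z<s)) P′x) ¬Px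

module Rank {_≺_ : Rel ℕ 0ℓ} (≺-isStrictTotalOrder : IsStrictTotalOrder _≡_ _≺_) (n : ℕ) where
  open IsStrictTotalOrder ≺-isStrictTotalOrder using (compare)
    renaming (irrefl to ≺-irrefl; trans to ≺-trans; asym to ≺-asym; _<?_ to _≺?_; _≟_ to _≡?_)

  _⪯_ : Rel ℕ 0ℓ
  y ⪯ x = y ≺ x ⊎ y ≡ x

  _⪯?_ : ∀ y x → Dec (y ⪯ x)
  y ⪯? x = (y ≺? x) ⊎-dec (y ≡? x)

  rank : ℕ → ℕ
  rank x = count (_⪯? x) n

  rank-≤ : ∀ x → rank x ≤ n
  rank-≤ x = count-≤ (_⪯? x) n

  rank-pos : ∀ {x} → x < n → 1 ≤ rank x
  rank-pos x<n = count-pos (_⪯? _) x<n (inj₂ refl)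

  rank-< : ∀ {x y} → x < n → y ≺ x → rank y < rank x
  rank-< {x} {y} x<n y≺x = count-< (_⪯? y) (_⪯? x) n ⪯y⇒⪯x x<n (inj₂ refl) x⋠y
    where
    ⪯y⇒⪯x : ∀ z → z < n → z ⪯ y → z ⪯ x
    ⪯y⇒⪯x z _ (inj₁ z≺y) = inj₁ (≺-trans z≺y y≺x)
    ⪯y⇒⪯x z _ (inj₂ refl) = inj₁ y≺x
    x⋠y : ¬ x ⪯ y
    x⋠y (inj₁ x≺y) = ≺-asym x≺y y≺x
    x⋠y (inj₂ refl) = ≺-irrefl refl y≺x

  rank-<⁻ : ∀ {x y} → x < n → y < n → rank y < rank x → y ≺ x
  rank-<⁻ {x} {y} x<n y<n ry<rx with compare y x
  ... | tri< y≺x _ _ = y≺x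
  ... | tri≈ _ refl _ = contradiction ry<rx (<-irrefl refl)
  ... | tri> _ _ x≺y = contradiction ry<rx (<-asym (rank-< y<n x≺y))

  rank-injective : InjectiveBelow n rank
  rank-injective x y x<n y<n rx≡ry with compare x y
  ... | tri< x≺y _ _ = contradiction rx≡ry (<⇒≢ (rank-< y<n x≺y))
  ... | tri≈ _ x≡y _ = x≡y
  ... | tri> _ _ y≺x = contradiction (sym rx≡ry) (<⇒≢ (rank-< x<n y≺x))

  rank-unique : (Q : ℕ → ℕ) → InjectiveBelow n Q → (∀ x → x < n → 1 ≤ Q x × Q x ≤ n) →
                (∀ x y → x < n → y < n → y ≺ x → Q y < Q x) → ∀ x → x < n → Q x ≡ rank x
  rank-unique Q inj bounds ≺⇒< x x<n = begin
    Q x                         ≡⟨ count-≤-value n Q inj bounds (Q x) (proj₂ (bounds x x<n)) ⟨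
    count (λ y → Q y ≤? Q x) n  ≡⟨ count-cong _ (_⪯? x) n (λ y y<n → mk⇔ (≤⇒⪯ y<n) (⪯⇒≤ y<n)) ⟩
    rank x                      ∎
    where
    open ≡-Reasoning
    ≤⇒⪯ : ∀ {y} → y < n → Q y ≤ Q x → y ⪯ x
    ≤⇒⪯ {y} y<n Qy≤Qx with compare y x
    ... | tri< y≺x _ _ = inj₁ y≺x
    ... | tri≈ _ y≡x _ = inj₂ y≡x
    ... | tri> _ _ x≺y = contradiction Qy≤Qx (<⇒≱ (≺⇒< y x y<n x<n x≺y))
    ⪯⇒≤ : ∀ {y} → y < n → y ⪯ x → Q y ≤ Q x
    ⪯⇒≤ {y} y<n (inj₁ y≺x) = <⇒≤ (≺⇒< x y x<n y<n y≺x)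
    ⪯⇒≤ _       (inj₂ refl) = ≤-refl

Alive : ℕ → (ℕ → ℕ) → ℕ → ℕ → Set
Alive n Q i x = ∃[ z ] z < n × i ≤ z × Q z < Q x

alive? : ∀ n Q i → Decidable (Alive n Q i)
alive? n Q i x = anyUpTo? (λ z → (i ≤? z) ×-dec (Q z <? Q x)) n

aliveCount : ℕ → (ℕ → ℕ) → ℕ → ℕ
aliveCount n Q i = count (alive? n Q i) i

Pattern231 : ℕ → (ℕ → ℕ) → ℕ → ℕ → ℕ → Set
Pattern231 n Q b c d = b < c × c < d × d < n × Q d < Q b × Q b < Q c

module PopOrder (n : ℕ) (a : ℕ → ℕ) where

  popTime : ℕ → ℕ
  popTime x = first (λ k → a k ≤? a x) (suc x) (n ∸ suc x)

  popTime-> : ∀ x → x < popTime x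
  popTime-> x = first-≥ _ (suc x) (n ∸ suc x)

  popTime-≤ : ∀ {x} → x < n → popTime x ≤ n
  popTime-≤ {x} x<n = subst (popTime x ≤_) (m+[n∸m]≡n x<n) (first-≤ _ (suc x) (n ∸ suc x))

  popTime-minimal : ∀ {x i} → x < i → i < popTime x → a x < a i
  popTime-minimal {x} x<i i<pop = ≰⇒> (first-minimal _ (suc x) (n ∸ suc x) x<i i<pop)

  popTime-drop : ∀ {x} → x < n → popTime x < n → a (popTime x) ≤ a x
  popTime-drop {x} x<n pop<n =
    first-satisfies _ (suc x) (n ∸ suc x) (subst (popTime x <_) (sym (m+[n∸m]≡n x<n)) pop<n)

  popTime-nested : ∀ {x z} → x < z → z < popTime x → z < n → popTime z ≤ popTime x
  popTime-nested {x} {z} x<z z<pop z<n with m≤n⇒m<n∨m≡n (popTime-≤ (<-trans x<z z<n))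
  ... | inj₂ pop≡n = subst (popTime z ≤_) (sym pop≡n) (popTime-≤ z<n)
  ... | inj₁ pop<n = ≮⇒≥ λ popx<popz → <⇒≱
          (<-trans (popTime-minimal x<z z<pop) (popTime-minimal z<pop popx<popz))
          (popTime-drop (<-trans x<z z<n) pop<n)

  -- Positions popped at the same time leave the stack in reverse order.
  _≺_ : Rel ℕ 0ℓ
  y ≺ x = popTime y < popTime x ⊎ (popTime y ≡ popTime x × x < y)

  ≺-irrefl : ∀ {x} → ¬ x ≺ x
  ≺-irrefl (inj₁ p<p)     = <-irrefl refl p<p
  ≺-irrefl (inj₂ (_ , x<x)) = <-irrefl refl x<x

  ≺-trans : ∀ {x y z} → x ≺ y → y ≺ z → x ≺ z
  ≺-trans (inj₁ p<q)        (inj₁ q<r)        = inj₁ (<-trans p<q q<r)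
  ≺-trans (inj₁ p<q)        (inj₂ (q≡r , _))  = inj₁ (subst (_ <_) q≡r p<q)
  ≺-trans (inj₂ (p≡q , _))  (inj₁ q<r)        = inj₁ (subst (_< _) (sym p≡q) q<r)
  ≺-trans (inj₂ (p≡q , y<x)) (inj₂ (q≡r , z<y)) = inj₂ (trans p≡q q≡r , <-trans z<y y<x)

  ≺⇒tri : ∀ {x y} → x ≺ y → Tri (x ≺ y) (x ≡ y) (y ≺ x)
  ≺⇒tri x≺y = tri< x≺y (λ { refl → ≺-irrefl x≺y }) (λ y≺x → ≺-irrefl (≺-trans x≺y y≺x))

  ≻⇒tri : ∀ {x y} → y ≺ x → Tri (x ≺ y) (x ≡ y) (y ≺ x)
  ≻⇒tri y≺x = tri> (λ x≺y → ≺-irrefl (≺-trans x≺y y≺x)) (λ { refl → ≺-irrefl y≺x }) y≺x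

  ≺-compare : Trichotomous _≡_ _≺_
  ≺-compare x y with <-cmp (popTime x) (popTime y)
  ... | tri< p<q _ _ = ≺⇒tri (inj₁ p<q)
  ... | tri> _ _ q<p = ≻⇒tri (inj₁ q<p)
  ... | tri≈ _ p≡q _ with <-cmp x y
  ...   | tri< x<y _ _  = ≻⇒tri (inj₂ (sym p≡q , x<y))
  ...   | tri≈ _ refl _ = tri≈ ≺-irrefl refl ≺-irrefl
  ...   | tri> _ _ y<x  = ≺⇒tri (inj₂ (p≡q , y<x))

  ≺-isStrictTotalOrder : IsStrictTotalOrder _≡_ _≺_
  ≺-isStrictTotalOrder = record
    { isStrictPartialOrder = record
      { isEquivalence = isEquivalence
      ; irrefl        = λ { refl → ≺-irrefl }
      ; trans         = ≺-trans
      ; <-resp-≈      = resp₂ _≺_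
      }
    ; compare = ≺-compare
    }

  open Rank ≺-isStrictTotalOrder n public

  rank-avoids-231 : ∀ {b c d} → ¬ Pattern231 n rank b c d
  rank-avoids-231 {b} {c} {d} (b<c , c<d , d<n , rd<rb , rb<rc)
    with rank-<⁻ (<-trans c<d d<n) (<-trans b<c (<-trans c<d d<n)) rb<rc
  ... | inj₂ (_ , c<b) = <-asym b<c c<b
  ... | inj₁ popb<popc with c <? popTime b
  ...   | yes c<popb = <⇒≱ popb<popc (popTime-nested b<c c<popb (<-trans c<d d<n))
  ...   | no c≮popb  = <-asym rd<rb (rank-< d<n (inj₁ popb<popd))
    where
    popb<popd : popTime b < popTime d
    popb<popd = ≤-<-trans (≮⇒≥ c≮popb) (<-trans c<d (popTime-> d))

  alive-rank⇔ : ∀ {x i} → x < i → i < n → Alive n rank i x ⇔ i < popTime x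
  alive-rank⇔ {x} {i} x<i i<n = mk⇔ alive⇒ alive⇐
    where
    alive⇒ : Alive n rank i x → i < popTime x
    alive⇒ (z , z<n , i≤z , rz<rx) = ≰⇒> λ popx≤i →
      <-asym rz<rx (rank-< z<n (inj₁ (≤-<-trans (≤-trans popx≤i i≤z) (popTime-> z))))
    i≺x : i < popTime x → i ≺ x
    i≺x i<popx with m≤n⇒m<n∨m≡n (popTime-nested x<i i<popx i<n)
    ... | inj₁ popi<popx = inj₁ popi<popx
    ... | inj₂ popi≡popx = inj₂ (popi≡popx , x<i)
    alive⇐ : i < popTime x → Alive n rank i x
    alive⇐ i<popx = i , i<n , ≤-refl , rank-< (<-trans x<i i<n) (i≺x i<popx)

module _ (n : ℕ) {a b : ℕ → ℕ} (a≗b : ∀ i → i < n → a i ≡ b i) where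
  private
    module A = PopOrder n a
    module B = PopOrder n b

  popTime-cong : ∀ {x} → x < n → A.popTime x ≡ B.popTime x
  popTime-cong {x} x<n = first-cong _ _ (suc x) (n ∸ suc x) λ k x<k k<end →
    let ak≡bk = a≗b k (subst (k <_) (m+[n∸m]≡n x<n) k<end); ax≡bx = a≗b x x<n in
    mk⇔ (subst₂ _≤_ ak≡bk ax≡bx) (subst₂ _≤_ (sym ak≡bk) (sym ax≡bx))

  rank-cong : ∀ {x} → x < n → A.rank x ≡ B.rank x
  rank-cong {x} x<n = count-cong (A._⪯? x) (B._⪯? x) n λ y y<n →
    let py≡ = popTime-cong y<n; px≡ = popTime-cong x<n in
    mk⇔ (subst₂ (⪯-by y) py≡ px≡) (subst₂ (⪯-by y) (sym py≡) (sym px≡))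
    where
    ⪯-by : ℕ → ℕ → ℕ → Set
    ⪯-by y p q = (p < q ⊎ (p ≡ q × x < y)) ⊎ y ≡ x

record StackHeights (n : ℕ) (a : ℕ → ℕ) : Set where
  field
    height₀     : a 0 ≡ 0
    height₁     : a 1 ≡ 0
    height-step : ∀ i → suc i < n → a (suc i) ≤ suc (a i)

module _ {n : ℕ} {a : ℕ → ℕ} (heights : StackHeights n a) where
  open StackHeights heights
  open PopOrder n a

  private
    Waiting : ℕ → ℕ → Pred ℕ 0ℓ
    Waiting i h x = i < popTime x × a x < h

    waiting? : ∀ i h → Decidable (Waiting i h)
    waiting? i h x = (i <? popTime x) ×-dec (a x <? h)

    waiting-step : ∀ {h x i} → x ≤ i → suc i < n → Waiting (suc i) h x ⇔ Waiting i (h ⊓ a (suc i)) x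
    waiting-step {h} {x} {i} x≤i 1+i<n = mk⇔ to from
      where
      to : Waiting (suc i) h x → Waiting i (h ⊓ a (suc i)) x
      to (1+i<pop , ax<h) = <-trans (n<1+n i) 1+i<pop , ⊓-pres-m< ax<h (popTime-minimal (s≤s x≤i) 1+i<pop)
      from : Waiting i (h ⊓ a (suc i)) x → Waiting (suc i) h x
      from (i<pop , ax<h′) = 1+i<pop , m<n⊓o⇒m<n h _ ax<h′
        where
        1+i<pop : suc i < popTime x
        1+i<pop with m≤n⇒m<n∨m≡n i<pop
        ... | inj₁ 1+i<pop = 1+i<pop
        ... | inj₂ 1+i≡pop = contradiction (subst (λ t → a t ≤ a x) (sym 1+i≡pop)
                                (popTime-drop (≤-<-trans x≤i (<-trans (n<1+n i) 1+i<n)) (subst (_< n) 1+i≡pop 1+i<n)))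
                               (<⇒≱ (m<n⊓o⇒m<o h _ ax<h′))

    -- The threshold h is generalised so that the induction on i goes through.
    count-waiting : ∀ i → i < n → ∀ h → count (waiting? i h) i ≡ h ⊓ a i
    count-waiting zero _ h = sym (trans (cong (h ⊓_) height₀) (⊓-zeroʳ h))
    count-waiting (suc i) 1+i<n h = begin
      count (waiting? (suc i) h) (suc i)  ≡⟨ count-cong (waiting? (suc i) h) (waiting? i h′) (suc i)
                                               (λ x x<1+i → waiting-step (≤-pred x<1+i) 1+i<n) ⟩
      count (waiting? i h′) (suc i)       ≡⟨ last-step (a i <? h′) ⟩
      h′                                  ∎
      where
      open ≡-Reasoning
      h′ = h ⊓ a (suc i)
      h′≤1+ai : h′ ≤ suc (a i)
      h′≤1+ai = ≤-trans (m⊓n≤n h _) (height-step i 1+i<n)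
      ih : count (waiting? i h′) i ≡ h′ ⊓ a i
      ih = count-waiting i (<-trans (n<1+n i) 1+i<n) h′
      last-step : Dec (a i < h′) → count (waiting? i h′) (suc i) ≡ h′
      last-step (yes ai<h′) = begin
        count (waiting? i h′) (suc i)  ≡⟨ count-suc-yes (waiting? i h′) (popTime-> i , ai<h′) ⟩
        suc (count (waiting? i h′) i)  ≡⟨ cong suc (trans ih (m≥n⇒m⊓n≡n (<⇒≤ ai<h′))) ⟩
        suc (a i)                      ≡⟨ ≤-antisym h′≤1+ai ai<h′ ⟨
        h′                             ∎
      last-step (no ai≮h′) = begin
        count (waiting? i h′) (suc i)  ≡⟨ count-suc-no (waiting? i h′) (ai≮h′ ∘ proj₂) ⟩
        count (waiting? i h′) i        ≡⟨ ih ⟩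
        h′ ⊓ a i                       ≡⟨ m≤n⇒m⊓n≡m (≮⇒≥ ai≮h′) ⟩
        h′                             ∎

  count-popTime : ∀ {i} → i < n → count (λ x → i <? popTime x) i ≡ a i
  count-popTime {i} i<n = begin
    count (λ x → i <? popTime x) i  ≡⟨ count-cong _ (waiting? i (a i)) i
                                         (λ x x<i → mk⇔ (λ i<pop → i<pop , popTime-minimal x<i i<pop) proj₁) ⟩
    count (waiting? i (a i)) i      ≡⟨ count-waiting i i<n (a i) ⟩
    a i ⊓ a i                       ≡⟨ ⊓-idem (a i) ⟩
    a i                             ∎
    where open ≡-Reasoning

  popTime0≤1 : popTime 0 ≤ 1
  popTime0≤1 = ≮⇒≥ λ 1<pop → first-minimal _ 1 (n ∸ 1) ≤-refl 1<pop (subst (_≤ a 0) (sym height₁) z≤n)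

  rank0≡1 : 0 < n → rank 0 ≡ 1
  rank0≡1 0<n = ≤-antisym
    (count-≤1 (_⪯? 0) n λ x y _ _ x⪯0 y⪯0 → trans (⪯0⇒≡0 x⪯0) (sym (⪯0⇒≡0 y⪯0)))
    (rank-pos 0<n)
    where
    ⪯0⇒≡0 : ∀ {x} → x ⪯ 0 → x ≡ 0
    ⪯0⇒≡0 (inj₂ x≡0) = x≡0
    ⪯0⇒≡0 {x} (inj₁ (inj₁ popx<pop0)) =
      contradiction (≤-pred (<-≤-trans popx<pop0 popTime0≤1)) (<⇒≱ (≤-<-trans z≤n (popTime-> x)))
    ⪯0⇒≡0 {x} (inj₁ (inj₂ (popx≡pop0 , 0<x))) =
      contradiction (≤-trans (≤-reflexive popx≡pop0) popTime0≤1) (<⇒≱ (≤-<-trans 0<x (popTime-> x)))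

module _ {n : ℕ} {Q : ℕ → ℕ} where

  alive-antitone : ∀ {i j x} → j ≤ i → Alive n Q i x → Alive n Q j x
  alive-antitone j≤i (z , z<n , i≤z , Qz<Qx) = z , z<n , ≤-trans j≤i i≤z , Qz<Qx

  aliveCount-step : ∀ i → aliveCount n Q (suc i) ≤ suc (aliveCount n Q i)
  aliveCount-step i = ≤-trans (count-suc-≤ (alive? n Q (suc i)) i)
    (s≤s (count-mono _ _ i λ _ _ → alive-antitone (n≤1+n i)))

module Avoider {n : ℕ} {Q : ℕ → ℕ}
               (Q-injective : InjectiveBelow n Q) (Q-bounds : ∀ x → x < n → 1 ≤ Q x × Q x ≤ n)
               (Q0≡1 : Q 0 ≡ 1) (no-231 : ∀ {b c d} → 1 ≤ b → ¬ Pattern231 n Q b c d) where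

  a : ℕ → ℕ
  a = aliveCount n Q

  open PopOrder n a

  alive⇒pos : ∀ {i x} → Alive n Q i x → 1 ≤ x
  alive⇒pos {x = zero} (z , z<n , _ , Qz<Q0) =
    contradiction (subst (Q z <_) Q0≡1 Qz<Q0) (<⇒≱ (s≤s (proj₁ (Q-bounds z z<n))))
  alive⇒pos {x = suc x} _ = s≤s z≤n

  -- Otherwise x, z and the smaller later entry would form a 231 pattern.
  alive⇒< : ∀ {x z} → x < z → z < n → Alive n Q z x → Q z < Q x
  alive⇒< {x} {z} x<z z<n alive@(w , w<n , z≤w , Qw<Qx) with m≤n⇒m<n∨m≡n z≤w | <-cmp (Q z) (Q x)
  ... | inj₂ refl | _ = Qw<Qx
  ... | inj₁ _    | tri< Qz<Qx _ _ = Qz<Qx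
  ... | inj₁ _    | tri≈ _ Qz≡Qx _ = contradiction (Q-injective z x z<n (<-trans x<z z<n) Qz≡Qx) (≢-sym (<⇒≢ x<z))
  ... | inj₁ z<w  | tri> _ _ Qx<Qz = contradiction (x<z , z<w , w<n , Qw<Qx , Qx<Qz) (no-231 (alive⇒pos alive))

  ¬alive⇒≤ : ∀ {i x z} → ¬ Alive n Q i x → i ≤ z → z < n → Q x ≤ Q z
  ¬alive⇒≤ dead i≤z z<n = ≮⇒≥ λ Qz<Qx → dead (_ , z<n , i≤z , Qz<Qx)

  aliveCount-1 : a 1 ≡ 0
  aliveCount-1 = count-zero (alive? n Q 1) 1 λ x x<1 alive →
    contradiction (≤-trans (alive⇒pos alive) (≤-pred x<1)) λ ()

  aliveCount-grows : ∀ {x i} → x < i → i < n → Alive n Q i x → a x < a i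
  aliveCount-grows {x} {i} x<i i<n alive-x@(z , z<n , i≤z , Qz<Qx) = begin-strict
    count (alive? n Q x) x        ≤⟨ count-mono _ _ x still-alive ⟩
    count (alive? n Q i) x        <⟨ ≤-reflexive (sym (count-suc-yes (alive? n Q i) alive-x)) ⟩
    count (alive? n Q i) (suc x)  ≤⟨ count-monoʳ (alive? n Q i) x<i ⟩
    count (alive? n Q i) i        ∎
    where
    open ≤-Reasoning
    still-alive : ∀ w → w < x → Alive n Q x w → Alive n Q i w
    still-alive w w<x alive-w = z , z<n , i≤z , <-trans Qz<Qx (alive⇒< w<x (<-trans x<i i<n) alive-w)

  aliveCount-drops : ∀ {x i} → x < i → i < n → ¬ Alive n Q i x → ∃[ k ] x < k × k ≤ i × a k ≤ a x
  aliveCount-drops {x} {i} x<i i<n dead-i = k , first-≥ dead? (suc x) (i ∸ x) , k≤i , drop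
    where
    dead? : Decidable (λ j → ¬ Alive n Q j x)
    dead? j = ∁? (alive? n Q j) x
    k : ℕ
    k = first dead? (suc x) (i ∸ x)
    k≤i : k ≤ i
    k≤i = ≮⇒≥ λ i<k → first-minimal dead? (suc x) (i ∸ x) x<i i<k dead-i
    dead-k : ¬ Alive n Q k x
    dead-k = first-satisfies dead? (suc x) (i ∸ x) (subst (k <_) (sym (cong suc (m+[n∸m]≡n (<⇒≤ x<i)))) (s≤s k≤i))
    k<n : k < n
    k<n = ≤-<-trans k≤i i<n
    alive-before-k : ∀ {w} → x < w → w < k → Alive n Q w x
    alive-before-k {w} x<w w<k = decidable-stable (alive? n Q w x) (first-minimal dead? (suc x) (i ∸ x) x<w w<k)
    alive⇒<x : ∀ w → w < k → Alive n Q k w → w < x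
    alive⇒<x w w<k alive-w@(z , z<n , k≤z , Qz<Qw) with <-cmp w x
    ... | tri< w<x _ _ = w<x
    ... | tri≈ _ refl _ = contradiction alive-w dead-k
    ... | tri> _ _ x<w = contradiction (¬alive⇒≤ dead-k k≤z z<n)
                           (<⇒≱ (<-trans Qz<Qw (alive⇒< x<w (<-trans w<k k<n) (alive-before-k x<w w<k))))
    drop : a k ≤ a x
    drop = count-≤-restrict _ _ k λ w w<k alive-w →
      alive⇒<x w w<k alive-w , alive-antitone (<⇒≤ (first-≥ dead? (suc x) (i ∸ x))) alive-w

  alive⇔popTime : ∀ {x i} → x < i → i < n → Alive n Q i x ⇔ i < popTime x
  alive⇔popTime {x} {i} x<i i<n = mk⇔ alive⇒ alive⇐
    where
    alive⇒ : Alive n Q i x → i < popTime x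
    alive⇒ alive = ≰⇒> λ popx≤i →
      let popx<n = ≤-<-trans popx≤i i<n in
      <⇒≱ (aliveCount-grows (popTime-> x) popx<n (alive-antitone popx≤i alive)) (popTime-drop (<-trans x<i i<n) popx<n)
    alive⇐ : i < popTime x → Alive n Q i x
    alive⇐ i<popx with alive? n Q i x
    ... | yes alive = alive
    ... | no dead with aliveCount-drops x<i i<n dead
    ...   | k , x<k , k≤i , ak≤ax = contradiction ak≤ax (<⇒≱ (popTime-minimal x<k (≤-<-trans k≤i i<popx)))

  ≺⇒< : ∀ x y → x < n → y < n → y ≺ x → Q y < Q x
  ≺⇒< x y x<n y<n (inj₂ (popy≡popx , x<y)) =
    alive⇒< x<y y<n (Equivalence.from (alive⇔popTime x<y y<n) (subst (y <_) popy≡popx (popTime-> y)))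
  ≺⇒< x y x<n y<n (inj₁ popy<popx) = by-cases (x <? popTime y)
    where
    popy<n : popTime y < n
    popy<n = <-≤-trans popy<popx (popTime-≤ x<n)
    y-dead : ¬ Alive n Q (popTime y) y
    y-dead alive = <-irrefl refl (Equivalence.to (alive⇔popTime (popTime-> y) popy<n) alive)
    by-cases : Dec (x < popTime y) → Q y < Q x
    by-cases (yes x<popy) = ≤-<-trans (¬alive⇒≤ y-dead ≤-refl popy<n)
      (alive⇒< x<popy popy<n (Equivalence.from (alive⇔popTime x<popy popy<n) popy<popx))
    by-cases (no x≮popy) = ≤∧≢⇒< (¬alive⇒≤ y-dead (≮⇒≥ x≮popy) x<n) λ Qy≡Qx →
      <-irrefl (cong popTime (Q-injective y x y<n x<n Qy≡Qx)) popy<popx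

  entry≡rank : ∀ x → x < n → Q x ≡ rank x
  entry≡rank = rank-unique Q Q-injective Q-bounds ≺⇒<

entry : ∀ {n} → Vec ℕ n → ℕ → ℕ
entry p x = val p (suc x)

entry-lookup : ∀ {n} (p : Vec ℕ n) i → entry p (toℕ i) ≡ lookup p i
entry-lookup (_ ∷ _)  Fin.zero    = refl
entry-lookup (_ ∷ xs) (Fin.suc i) = entry-lookup xs i

entry-fromℕ< : ∀ {n} (p : Vec ℕ n) {x} (x<n : x < n) → entry p x ≡ lookup p (fromℕ< x<n)
entry-fromℕ< p x<n = trans (cong (entry p) (sym (toℕ-fromℕ< x<n))) (entry-lookup p (fromℕ< x<n))

entry-tabulate : ∀ {n} (g : ℕ → ℕ) {x} → x < n → entry (tabulate {n = n} (g ∘ toℕ)) x ≡ g x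
entry-tabulate g {zero}  (s≤s _)   = refl
entry-tabulate g {suc x} (s≤s x<n) = entry-tabulate (g ∘ suc) x<n

entry-ext : ∀ {n} (p q : Vec ℕ n) → (∀ x → x < n → entry p x ≡ entry q x) → p ≡ q
entry-ext []       []       _   = refl
entry-ext (x ∷ xs) (y ∷ ys) p≗q = cong₂ _∷_ (p≗q 0 z<s) (entry-ext xs ys λ z z<n → p≗q (suc z) (s<s z<n))

isPerm-injective : ∀ {n} {p : Vec ℕ n} → IsPerm p → InjectiveBelow n (entry p)
isPerm-injective {p = p} (_ , lookup-injective) x y x<n y<n px≡py =
  trans (sym (toℕ-fromℕ< x<n)) (trans (cong toℕ (lookup-injective _ _ lookup≡)) (toℕ-fromℕ< y<n))
  where lookup≡ = trans (sym (entry-fromℕ< p x<n)) (trans px≡py (entry-fromℕ< p y<n))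

isPerm-bounds : ∀ {n} {p : Vec ℕ n} → IsPerm p → ∀ x → x < n → 1 ≤ entry p x × entry p x ≤ n
isPerm-bounds {n} {p} (lookup-bounds , _) x x<n =
  subst (λ v → 1 ≤ v × v ≤ n) (sym (entry-fromℕ< p x<n)) (lookup-bounds (fromℕ< x<n))

count-filterᵇ : ∀ (B : ℕ → Bool) (g : ℕ → ℕ) k →
                length (filterᵇ B (applyUpTo g k)) ≡ count (λ x → T? (B (g x))) k
count-filterᵇ B g zero = refl
count-filterᵇ B g (suc k) = begin
  length (filterᵇ B (applyUpTo g (suc k)))             ≡⟨ cong (length ∘ filterᵇ B) (applyUpTo-∷ʳ g k) ⟨
  length (filterᵇ B (applyUpTo g k ∷ʳ g k))            ≡⟨ cong length (filter-++ (T? ∘ B) (applyUpTo g k) [ g k ]) ⟩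
  length (filterᵇ B (applyUpTo g k) ++ filterᵇ B [ g k ]) ≡⟨ length-++ (filterᵇ B (applyUpTo g k)) ⟩
  length (filterᵇ B (applyUpTo g k)) + #last           ≡⟨ cong (_+ #last) (count-filterᵇ B g k) ⟩
  count P? k + #last                                   ≡⟨ last-step (P? k) ⟩
  count P? (suc k)                                     ∎
  where
  open ≡-Reasoning
  #last : ℕ
  #last = length (filterᵇ B [ g k ])
  P? : Decidable (λ x → T (B (g x)))
  P? x = T? (B (g x))
  last-step : Dec (T (B (g k))) → count P? k + length (filterᵇ B [ g k ]) ≡ count P? (suc k)
  last-step (yes t) = begin
    count P? k + length (filterᵇ B [ g k ])  ≡⟨ cong (λ xs → count P? k + length xs) (filter-accept (T? ∘ B) t) ⟩
    count P? k + 1                           ≡⟨ +-comm _ 1 ⟩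
    suc (count P? k)                         ≡⟨ count-suc-yes P? t ⟨
    count P? (suc k)                         ∎
  last-step (no ¬t) = begin
    count P? k + length (filterᵇ B [ g k ])  ≡⟨ cong (λ xs → count P? k + length xs) (filter-reject (T? ∘ B) ¬t) ⟩
    count P? k + 0                           ≡⟨ +-identityʳ _ ⟩
    count P? k                               ≡⟨ count-suc-no P? ¬t ⟨
    count P? (suc k)                         ∎

any-applyUpTo⇔ : ∀ (C : ℕ → Bool) (g : ℕ → ℕ) k → T (any C (applyUpTo g k)) ⇔ (∃[ y ] y < k × T (C (g y)))
any-applyUpTo⇔ C g k = mk⇔ (λ t → applyUpTo⁻ g (Equivalence.from any⇔ t))
                            (λ (y , y<k , t) → Equivalence.to any⇔ (applyUpTo⁺ g t y<k))

label≡aliveCount : ∀ {n} (p : Vec ℕ n) i → label p i ≡ aliveCount n (entry p) i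
label≡aliveCount {n} p i = begin
  label p i                                  ≡⟨ cong (length ∘ filterᵇ later-smaller) (map-upTo suc i) ⟩
  length (filterᵇ later-smaller (applyUpTo suc i))
                                             ≡⟨ count-filterᵇ later-smaller suc i ⟩
  count (λ x → T? (later-smaller (suc x))) i ≡⟨ count-cong _ (alive? n (entry p) i) i
                                                  (λ x _ → later-smaller⇔alive x) ⟩
  aliveCount n (entry p) i                   ∎
  where
  open ≡-Reasoning
  later-smaller : ℕ → Bool
  later-smaller j = any (λ s → val p s <ᵇ val p j) (range i (n ∸ i))
  later-smaller⇔alive : ∀ x → T (later-smaller (suc x)) ⇔ Alive n (entry p) i x
  later-smaller⇔alive x = Eq.trans
    (subst (λ zs → T (any smaller zs) ⇔ (∃[ y ] y < n ∸ i × T (smaller (i + suc y))))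
           (sym (map-upTo (λ k → i + suc k) (n ∸ i))) (any-applyUpTo⇔ smaller (λ k → i + suc k) (n ∸ i)))
    (mk⇔ to from)
    where
    smaller : ℕ → Bool
    smaller s = val p s <ᵇ entry p x
    to : ∃[ y ] y < n ∸ i × T (val p (i + suc y) <ᵇ entry p x) → Alive n (entry p) i x
    to (y , y<n∸i , t) = i + y , i+y<n , m≤m+n i y , subst (λ s → val p s < entry p x) (+-suc i y) (<ᵇ⇒< _ _ t)
      where
      i<n : i < n
      i<n = m∸n≢0⇒n<m λ n∸i≡0 → n≮0 (subst (y <_) n∸i≡0 y<n∸i)
      i+y<n : i + y < n
      i+y<n = subst (i + y <_) (m+[n∸m]≡n (<⇒≤ i<n)) (+-monoʳ-< i y<n∸i)
    from : Alive n (entry p) i x → ∃[ y ] y < n ∸ i × T (val p (i + suc y) <ᵇ entry p x)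
    from (z , z<n , i≤z , Qz<Qx) = z ∸ i , ∸-monoˡ-< z<n i≤z ,
      <⇒<ᵇ (subst (λ s → val p s < entry p x) (sym (trans (+-suc i (z ∸ i)) (cong suc (m+[n∸m]≡n i≤z)))) Qz<Qx)

StrictlyIncreasing : (ℕ → ℕ) → Set
StrictlyIncreasing w = ∀ k → w k < w (suc k)

module _ {w : ℕ → ℕ} (w-increasing : StrictlyIncreasing w) where

  strictlyIncreasing-< : ∀ {i j} → i < j → w i < w j
  strictlyIncreasing-< {i} {suc j} i<1+j with m≤n⇒m<n∨m≡n (≤-pred i<1+j)
  ... | inj₁ i<j  = <-trans (strictlyIncreasing-< i<j) (w-increasing j)
  ... | inj₂ refl = w-increasing i

  strictlyIncreasing-<⁻ : ∀ {i j} → w i < w j → i < j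
  strictlyIncreasing-<⁻ {i} {j} wi<wj = ≰⇒> λ j≤i → case m≤n⇒m<n∨m≡n j≤i of λ where
    (inj₁ j<i)  → <-asym wi<wj (strictlyIncreasing-< j<i)
    (inj₂ refl) → <-irrefl refl wi<wj

contains-via : ∀ {k n} (q : Vec ℕ k) (p : Vec ℕ n) {u w : ℕ → ℕ} →
               StrictlyIncreasing u → StrictlyIncreasing w → (u<n : ∀ j → u (toℕ j) < n) →
               (∀ j → entry p (u (toℕ j)) ≡ w (lookup q j)) → Contains q p
contains-via q p {u} {w} u-increasing w-increasing u<n values = ι , ι-monotone , ι-isomorphic
  where
  ι : Fin _ → Fin _
  ι j = fromℕ< (u<n j)
  toℕ-ι : ∀ j → toℕ (ι j) ≡ u (toℕ j)
  toℕ-ι j = toℕ-fromℕ< (u<n j)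
  lookup-ι : ∀ j → lookup p (ι j) ≡ w (lookup q j)
  lookup-ι j = trans (sym (entry-fromℕ< p (u<n j))) (values j)
  ι-monotone : ∀ i j → toℕ i < toℕ j → toℕ (ι i) < toℕ (ι j)
  ι-monotone i j i<j = subst₂ _<_ (sym (toℕ-ι i)) (sym (toℕ-ι j)) (strictlyIncreasing-< u-increasing i<j)
  ι-isomorphic : ∀ i j → (lookup q i < lookup q j → lookup p (ι i) < lookup p (ι j))
                       × (lookup p (ι i) < lookup p (ι j) → lookup q i < lookup q j)
  ι-isomorphic i j =
    (λ qi<qj → subst₂ _<_ (sym (lookup-ι i)) (sym (lookup-ι j)) (strictlyIncreasing-< w-increasing qi<qj)) ,
    (λ pi<pj → strictlyIncreasing-<⁻ w-increasing (subst₂ _<_ (lookup-ι i) (lookup-ι j) pi<pj))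

-- With p₁ = 1 in front, a 231 pattern after position 1 is a 1342 pattern.
inDomain⇒no-231 : ∀ {m} {p : Vec ℕ (suc m)} → InDomain p →
                  ∀ {b c d} → 1 ≤ b → ¬ Pattern231 (suc m) (entry p) b c d
inDomain⇒no-231 {m} {p} (perm , p₁≡1 , avoids) {b} {c} {d} 1≤b (b<c , c<d , d<n , Qd<Qb , Qb<Qc) =
  avoids (contains-via pat1342 p u-increasing w-increasing u<n values)
  where
  Q = entry p
  u : ℕ → ℕ
  u 0 = 0
  u 1 = b
  u 2 = c
  u 3 = d
  u (suc (suc (suc (suc k)))) = d + suc k
  u-increasing : StrictlyIncreasing u
  u-increasing 0 = 1≤b
  u-increasing 1 = b<c
  u-increasing 2 = c<d
  u-increasing 3 = m<m+n d z<s
  u-increasing (suc (suc (suc (suc k)))) = +-monoʳ-< d (n<1+n (suc k))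
  w : ℕ → ℕ
  w 0 = 0
  w 1 = Q 0
  w 2 = Q d
  w 3 = Q b
  w 4 = Q c
  w (suc (suc (suc (suc (suc k))))) = Q c + suc k
  Q0<Qd : Q 0 < Q d
  Q0<Qd = ≤∧≢⇒< (subst (_≤ Q d) (sym p₁≡1) (proj₁ (isPerm-bounds {p = p} perm d d<n)))
                λ Q0≡Qd → <-irrefl (isPerm-injective {p = p} perm 0 d z<s d<n Q0≡Qd)
                                   (≤-<-trans z≤n (<-trans b<c c<d))
  w-increasing : StrictlyIncreasing w
  w-increasing 0 = subst (0 <_) (sym p₁≡1) z<s
  w-increasing 1 = Q0<Qd
  w-increasing 2 = Qd<Qb
  w-increasing 3 = Qb<Qc
  w-increasing 4 = m<m+n (Q c) z<s
  w-increasing (suc (suc (suc (suc (suc k))))) = +-monoʳ-< (Q c) (n<1+n (suc k))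
  c<n = <-trans c<d d<n
  u<n : ∀ j → u (toℕ j) < suc m
  u<n Fin.zero = z<s
  u<n (Fin.suc Fin.zero) = <-trans b<c c<n
  u<n (Fin.suc (Fin.suc Fin.zero)) = c<n
  u<n (Fin.suc (Fin.suc (Fin.suc Fin.zero))) = d<n
  values : ∀ j → Q (u (toℕ j)) ≡ w (lookup pat1342 j)
  values Fin.zero = refl
  values (Fin.suc Fin.zero) = refl
  values (Fin.suc (Fin.suc Fin.zero)) = refl
  values (Fin.suc (Fin.suc (Fin.suc Fin.zero))) = refl

no-231⇒avoids1342 : ∀ {n} {p : Vec ℕ n} → (∀ {b c d} → ¬ Pattern231 n (entry p) b c d) → Avoids pat1342 p
no-231⇒avoids1342 {p = p} no-231 (ι , ι-monotone , ι-isomorphic) =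
  no-231 (ι-monotone j₁ j₂ ≤-refl , ι-monotone j₂ j₃ ≤-refl , toℕ<n (ι j₃) ,
          ordered j₃ j₁ ≤-refl , ordered j₁ j₂ ≤-refl)
  where
  j₁ j₂ j₃ : Fin 4
  j₁ = Fin.suc Fin.zero
  j₂ = Fin.suc (Fin.suc Fin.zero)
  j₃ = Fin.suc (Fin.suc (Fin.suc Fin.zero))
  ordered : ∀ i j → lookup pat1342 i < lookup pat1342 j → entry p (toℕ (ι i)) < entry p (toℕ (ι j))
  ordered i j qi<qj =
    subst₂ _<_ (sym (entry-lookup p (ι i))) (sym (entry-lookup p (ι j))) (proj₁ (ι-isomorphic i j) qi<qj)

pathOf : ℕ → (ℕ → ℕ) → PTree
pathOf k h = chain (h k) (map h (downFrom k))

spine : ℕ → (ℕ → ℕ) → PTree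
spine m a = chain (a m) (map (a ∘ suc) (downFrom m))

labelAt : PTree → ℕ → ℕ
labelAt (node l _)       zero    = l
labelAt (node _ [])      (suc d) = 0
labelAt (node _ (c ∷ _)) (suc d) = labelAt c d

labelOf-pathOf : ∀ k h → labelOf (pathOf k h) ≡ h k
labelOf-pathOf zero    h = refl
labelOf-pathOf (suc k) h = refl

labelAt-pathOf : ∀ k h {d} → d ≤ k → labelAt (pathOf k h) d ≡ h (k ∸ d)
labelAt-pathOf zero    h z≤n = refl
labelAt-pathOf (suc k) h z≤n = refl
labelAt-pathOf (suc k) h (s≤s d≤k) = labelAt-pathOf k h d≤k

pathOf-cong : ∀ k {h h′} → (∀ i → i ≤ k → h i ≡ h′ i) → pathOf k h ≡ pathOf k h′
pathOf-cong zero    h≗h′ = cong (λ l → node l []) (h≗h′ 0 z≤n)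
pathOf-cong (suc k) h≗h′ = cong₂ (λ l t → node l (t ∷ [])) (h≗h′ (suc k) ≤-refl)
                                  (pathOf-cong k λ i i≤k → h≗h′ i (m≤n⇒m≤1+n i≤k))

isPath-chain : ∀ x xs → IsPath (chain x xs)
isPath-chain x []       = end
isPath-chain x (y ∷ ys) = step (isPath-chain y ys)

size-chain : ∀ x xs → size (chain x xs) ≡ suc (length xs)
size-chain x []       = refl
size-chain x (y ∷ ys) = cong suc (trans (+-identityʳ _) (size-chain y ys))

nonRootOK-leaf⁻ : ∀ {l} → NonRootOK (node l []) → l ≡ 0
nonRootOK-leaf⁻ leaf = refl

nonRootOK-path⁻ : ∀ {l c} → NonRootOK (node l (c ∷ [])) → NonRootOK c × l ≤ suc (labelOf c + 0)
nonRootOK-path⁻ (internal (ok ∷ []) bound) = ok , bound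

nonRootOK-pathOf : ∀ k h → NonRootOK (pathOf k h) ⇔ (h 0 ≡ 0 × ∀ i → i < k → h (suc i) ≤ suc (h i))
nonRootOK-pathOf k h = mk⇔ (to k) (from k)
  where
  to : ∀ k → NonRootOK (pathOf k h) → h 0 ≡ 0 × ∀ i → i < k → h (suc i) ≤ suc (h i)
  to zero ok = nonRootOK-leaf⁻ ok , λ _ ()
  to (suc k) ok with nonRootOK-path⁻ ok
  ... | ok′ , bound with to k ok′
  ...   | h0≡0 , steps = h0≡0 , λ i i<1+k → case m≤n⇒m<n∨m≡n (≤-pred i<1+k) of λ where
          (inj₁ i<k)  → steps i i<k
          (inj₂ refl) → subst (λ l → h (suc i) ≤ suc l) (trans (+-identityʳ _) (labelOf-pathOf i h)) bound
  from : ∀ k → h 0 ≡ 0 × (∀ i → i < k → h (suc i) ≤ suc (h i)) → NonRootOK (pathOf k h)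
  from zero (h0≡0 , _) = subst (λ l → NonRootOK (node l [])) (sym h0≡0) leaf
  from (suc k) (h0≡0 , steps) =
    internal (from k (h0≡0 , λ i i<k → steps i (m<n⇒m<1+n i<k)) ∷ [])
             (subst (λ l → h (suc k) ≤ suc l) (sym (trans (+-identityʳ _) (labelOf-pathOf k h))) (steps k ≤-refl))

path≡pathOf-labelAt : ∀ {t} → IsPath t → ∀ {k} → size t ≡ suc k → t ≡ pathOf k (λ i → labelAt t (k ∸ i))
path≡pathOf-labelAt end refl = refl
path≡pathOf-labelAt {t@(node l (c@(node _ cs) ∷ []))} (step c-path) size≡
  with trans (sym (+-identityʳ _)) (suc-injective size≡)
... | refl = cong₂ (λ x y → node x (y ∷ [])) (cong (labelAt t) (sym (n∸n≡0 k)))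
                   (trans (path≡pathOf-labelAt c-path refl)
                          (pathOf-cong k λ i i≤k → cong (labelAt t) (sym (+-∸-assoc 1 i≤k))))
  where k = sizes cs

infixr 5 _∷ₛ_
_∷ₛ_ : ℕ → (ℕ → ℕ) → ℕ → ℕ
(x ∷ₛ h) zero    = x
(x ∷ₛ h) (suc i) = h i

spine-isBeta01 : ∀ m {a} → StackHeights (suc m) a → IsBeta01 (spine m a)
spine-isBeta01 zero    heights = StackHeights.height₀ heights , []
spine-isBeta01 (suc k) {a} heights =
  sym (trans (+-identityʳ _) (labelOf-pathOf k (a ∘ suc))) ,
  Equivalence.from (nonRootOK-pathOf k (a ∘ suc)) (height₁ , λ i i<k → height-step (suc i) (s≤s (s≤s i<k))) ∷ []
  where open StackHeights heights

spine-inCodomain : ∀ m {a} → StackHeights (suc m) a → InCodomain (suc m) (spine m a)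
spine-inCodomain m heights =
  spine-isBeta01 m heights , isPath-chain _ _ ,
  trans (size-chain _ _) (cong suc (trans (length-map _ (downFrom m)) (length-downFrom m)))

pathOf-spine : ∀ m h → IsBeta01 (pathOf m h) → StackHeights (suc m) (0 ∷ₛ h) × pathOf m h ≡ spine m (0 ∷ₛ h)
pathOf-spine zero    h (h0≡0 , []) =
  record { height₀ = refl ; height₁ = h0≡0 ; height-step = λ { _ (s≤s ()) } } ,
  cong (λ l → node l []) h0≡0
pathOf-spine (suc k) h (root≡ , ok ∷ []) with Equivalence.to (nonRootOK-pathOf k h) ok
... | h0≡0 , steps =
  record { height₀ = refl ; height₁ = h0≡0 ; height-step = heights-step } ,
  cong (λ l → node l (pathOf k h ∷ [])) (trans root≡ (trans (+-identityʳ _) (labelOf-pathOf k h)))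
  where
  heights-step : ∀ i → suc i < suc (suc k) → (0 ∷ₛ h) (suc i) ≤ suc ((0 ∷ₛ h) i)
  heights-step zero    _             = subst (_≤ 1) (sym h0≡0) z≤n
  heights-step (suc i) (s≤s (s≤s i<k)) = steps i i<k

inCodomain⇒spine : ∀ m t → InCodomain (suc m) t → ∃[ a ] StackHeights (suc m) a × t ≡ spine m a
inCodomain⇒spine m t (β , path , size≡) =
  let t≡path = path≡pathOf-labelAt path size≡
      heights , path≡spine = pathOf-spine m _ (subst IsBeta01 t≡path β)
  in _ , heights , trans t≡path path≡spine

spine-cong : ∀ m {a b} → (∀ i → i ≤ m → a i ≡ b i) → spine m a ≡ spine m b
spine-cong zero    a≗b = cong (λ l → node l []) (a≗b 0 z≤n)
spine-cong (suc k) a≗b = cong₂ (λ l t → node l (t ∷ [])) (a≗b (suc k) ≤-refl)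
                               (pathOf-cong k λ i i≤k → a≗b (suc i) (s≤s i≤k))

spine-injective : ∀ m {a b} → spine m a ≡ spine m b → ∀ i → i < m → a (suc i) ≡ b (suc i)
spine-injective (suc k) {a} {b} a≡b i (s≤s i≤k) = begin
  a (suc i)                                  ≡⟨ labelAt-spine a ⟨
  labelAt (spine (suc k) a) (suc (k ∸ i))    ≡⟨ cong (λ t → labelAt t (suc (k ∸ i))) a≡b ⟩
  labelAt (spine (suc k) b) (suc (k ∸ i))    ≡⟨ labelAt-spine b ⟩
  b (suc i)                                  ∎
  where
  open ≡-Reasoning
  labelAt-spine : ∀ a → labelAt (spine (suc k) a) (suc (k ∸ i)) ≡ a (suc i)
  labelAt-spine a = trans (labelAt-pathOf k (a ∘ suc) (m∸n≤m k i)) (cong (a ∘ suc) (m∸[m∸n]≡n i≤k))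

module _ {n : ℕ} {Q Q′ : ℕ → ℕ} (Q≗Q′ : ∀ x → x < n → Q x ≡ Q′ x) where

  alive-transport : ∀ {i x} → x < n → Alive n Q i x → Alive n Q′ i x
  alive-transport {x = x} x<n (z , z<n , i≤z , Qz<Qx) = z , z<n , i≤z , subst₂ _<_ (Q≗Q′ z z<n) (Q≗Q′ x x<n) Qz<Qx

  pattern231-transport : ∀ {b c d} → Pattern231 n Q b c d → Pattern231 n Q′ b c d
  pattern231-transport {b} {c} {d} (b<c , c<d , d<n , Qd<Qb , Qb<Qc) =
    b<c , c<d , d<n ,
    subst₂ _<_ (Q≗Q′ d d<n) (Q≗Q′ b b<n) Qd<Qb , subst₂ _<_ (Q≗Q′ b b<n) (Q≗Q′ c c<n) Qb<Qc
    where
    c<n = <-trans c<d d<n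
    b<n = <-trans b<c c<n

module DomainElement {m : ℕ} (p : Vec ℕ (suc m)) (dom : InDomain p) where
  open Avoider (isPerm-injective {p = p} (proj₁ dom)) (isPerm-bounds {p = p} (proj₁ dom)) (proj₁ (proj₂ dom))
               (inDomain⇒no-231 {p = p} dom)

  labels-stackHeights : StackHeights (suc m) (label p)
  labels-stackHeights = record
    { height₀     = refl
    ; height₁     = trans (label≡aliveCount p 1) aliveCount-1
    ; height-step = λ i _ → subst₂ (λ u v → u ≤ suc v) (sym (label≡aliveCount p (suc i))) (sym (label≡aliveCount p i))
                                   (aliveCount-step i)
    }

  entry≡rank-of-labels : ∀ x → x < suc m → entry p x ≡ PopOrder.rank (suc m) (label p) x
  entry≡rank-of-labels x x<n = trans (entry≡rank x x<n) (rank-cong (suc m) (λ i _ → sym (label≡aliveCount p i)) x<n)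

module RankVector {m : ℕ} {a : ℕ → ℕ} (heights : StackHeights (suc m) a) where
  open PopOrder (suc m) a

  rankVector : Vec ℕ (suc m)
  rankVector = tabulate (rank ∘ toℕ)

  entry-rankVector : ∀ x → x < suc m → entry rankVector x ≡ rank x
  entry-rankVector x = entry-tabulate rank

  lookup-rankVector : ∀ i → lookup rankVector i ≡ rank (toℕ i)
  lookup-rankVector = lookup∘tabulate (rank ∘ toℕ)

  rankVector-inDomain : InDomain rankVector
  rankVector-inDomain = (bounds , injective) , trans (entry-rankVector 0 z<s) (rank0≡1 heights z<s) ,
    no-231⇒avoids1342 {p = rankVector} (rank-avoids-231 ∘ pattern231-transport entry-rankVector)
    where
    bounds : ∀ i → 1 ≤ lookup rankVector i × lookup rankVector i ≤ suc m
    bounds i = subst (λ v → 1 ≤ v × v ≤ suc m) (sym (lookup-rankVector i)) (rank-pos (toℕ<n i) , rank-≤ (toℕ i))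
    injective : ∀ i j → lookup rankVector i ≡ lookup rankVector j → i ≡ j
    injective i j ri≡rj = toℕ-injective (rank-injective _ _ (toℕ<n i) (toℕ<n j)
      (trans (sym (lookup-rankVector i)) (trans ri≡rj (lookup-rankVector j))))

  label-rankVector : ∀ i → i < suc m → label rankVector i ≡ a i
  label-rankVector i i<n = begin
    label rankVector i                     ≡⟨ label≡aliveCount rankVector i ⟩
    aliveCount (suc m) (entry rankVector) i ≡⟨ count-cong _ _ i alive⇔ ⟩
    count (λ x → i <? popTime x) i         ≡⟨ count-popTime heights i<n ⟩
    a i                                    ∎
    where
    open ≡-Reasoning
    alive⇔ : ∀ x → x < i → Alive (suc m) (entry rankVector) i x ⇔ i < popTime x
    alive⇔ x x<i = let x<n = <-trans x<i i<n in Eq.trans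
      (mk⇔ (alive-transport entry-rankVector x<n) (alive-transport (λ y y<n → sym (entry-rankVector y y<n)) x<n))
      (alive-rank⇔ x<i i<n)

  f-rankVector : f rankVector ≡ spine m a
  f-rankVector = spine-cong m λ i i≤m → label-rankVector i (s≤s i≤m)

mainTheorem1 : (m : ℕ) →
    ((p : Vec ℕ (suc m)) → InDomain p → InCodomain (suc m) (f p))
    × ((p q : Vec ℕ (suc m)) → InDomain p → InDomain q → f p ≡ f q → p ≡ q)
    × ((t : PTree) → InCodomain (suc m) t →
         Σ (Vec ℕ (suc m)) λ p → InDomain p × f p ≡ t)
mainTheorem1 m = f-into , f-injective , f-onto
  where
  f-into : ∀ p → InDomain p → InCodomain (suc m) (f p)
  f-into p dom = spine-inCodomain m (DomainElement.labels-stackHeights p dom)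
  f-injective : ∀ p q → InDomain p → InDomain q → f p ≡ f q → p ≡ q
  f-injective p q dom-p dom-q fp≡fq = entry-ext p q λ x x<n → begin
    entry p x                             ≡⟨ DomainElement.entry≡rank-of-labels p dom-p x x<n ⟩
    PopOrder.rank (suc m) (label p) x     ≡⟨ rank-cong (suc m) labels≗ x<n ⟩
    PopOrder.rank (suc m) (label q) x     ≡⟨ DomainElement.entry≡rank-of-labels q dom-q x x<n ⟨
    entry q x                             ∎
    where
    open ≡-Reasoning
    labels≗ : ∀ i → i < suc m → label p i ≡ label q i
    labels≗ zero    _         = refl
    labels≗ (suc i) (s≤s i<m) = spine-injective m {label p} {label q} fp≡fq i i<m
  f-onto : ∀ t → InCodomain (suc m) t → Σ (Vec ℕ (suc m)) λ p → InDomain p × f p ≡ t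
  f-onto t t∈ with inCodomain⇒spine m t t∈
  ... | a , heights , t≡spine = rankVector , rankVector-inDomain , trans f-rankVector (sym t≡spine)
    where open RankVector heights
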